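{- Let $A$ be a pseudo-BCI algebra and let $d:A\to A$ be a map that is both a type I and a type II implicative derivation on $A$. If there exists $a\in A$ such that $a\le d(x)$ for all $x\in A$, then: (1) $d(1)=1$; (2) $A$ is a pseudo-BCK algebra, i.e. $x\le 1$ for all $x\in A$.
   Context: A pseudo-BCI algebra is a structure $(A,\to,\rightsquigarrow,1)$ of type $(2,2,0)$ such that for all $x,y,z\in A$: $(x\to y)\rightsquigarrow[(y\to z)\rightsquigarrow(x\to z)]=1$; $(x\rightsquigarrow y)\to[(y\rightsquigarrow z)\to(x\rightsquigarrow z)]=1$; $1\to x=x$; $1\rightsquigarrow x=x$; and $x\to y=1$, $y\to x=1$ imply $x=y$. Write $x\le y$ iff $x\to y=1$. Put $x\Cup_1 y=(x\to y)\rightsquigarrow y$ and $x\Cup_2 y=(x\rightsquigarrow y)\to y$. A map $d:A\to A$ is a type I implicative derivation if $d(x\to y)=(x\to d(y))\Cup_2(d(x)\to y)$ and $d(x\rightsquigarrow y)=(x\rightsquigarrow d(y))\Cup_1(d(x)\rightsquigarrow y)$ for all $x,y$; it is a type II implicative derivation if $d(x\to y)=(d(x)\to y)\Cup_2(x\to d(y))$ and $d(x\rightsquigarrow y)=(d(x)\rightsquigarrow y)\Cup_1(x\rightsquigarrow d(y))$ for all $x,y$. -}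

module Defs where

open import Level using (Level; suc)
open import Relation.Binary.PropositionalEquality using (_≡_)

record PseudoBCI (ℓ : Level) : Set (suc ℓ) where
  infixr 5 _⇒_ _⇝_
  field
    Carrier : Set ℓ
    _⇒_     : Carrier → Carrier → Carrier
    _⇝_     : Carrier → Carrier → Carrier
    𝟏       : Carrier
    ax1 : ∀ x y z → (x ⇒ y) ⇝ ((y ⇒ z) ⇝ (x ⇒ z)) ≡ 𝟏
    ax2 : ∀ x y z → (x ⇝ y) ⇒ ((y ⇝ z) ⇒ (x ⇝ z)) ≡ 𝟏
    ax3 : ∀ x → 𝟏 ⇒ x ≡ x
    ax4 : ∀ x → 𝟏 ⇝ x ≡ x
    ax5 : ∀ x y → x ⇒ y ≡ 𝟏 → y ⇒ x ≡ 𝟏 → x ≡ y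

  _≤_ : Carrier → Carrier → Set ℓ
  x ≤ y = x ⇒ y ≡ 𝟏

  _⋓₁_ : Carrier → Carrier → Carrier
  x ⋓₁ y = (x ⇒ y) ⇝ y

  _⋓₂_ : Carrier → Carrier → Carrier
  x ⋓₂ y = (x ⇝ y) ⇒ y

  IsTypeI : (Carrier → Carrier) → Set ℓ
  IsTypeI d = (∀ x y → d (x ⇒ y) ≡ (x ⇒ d y) ⋓₂ (d x ⇒ y))
            × (∀ x y → d (x ⇝ y) ≡ (x ⇝ d y) ⋓₁ (d x ⇝ y))
    where open import Data.Product using (_×_)

  IsTypeII : (Carrier → Carrier) → Set ℓ
  IsTypeII d = (∀ x y → d (x ⇒ y) ≡ (d x ⇒ y) ⋓₂ (x ⇒ d y))
             × (∀ x y → d (x ⇝ y) ≡ (d x ⇝ y) ⋓₁ (x ⇝ d y))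
    where open import Data.Product using (_×_)

  IsPseudoBCK : Set ℓ
  IsPseudoBCK = ∀ x → x ≤ 𝟏

-- Let a be a lower bound of the image of d.  Since a → d y = 1, the type I law gives
-- d (a → y) = (d a → y) → (d a → y) = 1, while the type II law gives
-- d (a → y) = (d a → y) ⋓₂ 1.  So (d a → y) ⋓₂ 1 = 1 for all y, whence d a → y ≤ 1;
-- at y = 1 the left side is (d a ⋓₁ 1) → 1 = d a → 1, so d a ≤ 1, and then
-- y = 1 → y ≤ d a → y ≤ 1.
module Submission where

open import Defs
open import Level using (Level)
open import Data.Product using (_×_; ∃; _,_)
open import Relation.Binary.PropositionalEquality
  using (_≡_; sym; trans; cong; cong₂; subst; module ≡-Reasoning)

module PseudoBCIProperties {ℓ : Level} (A : PseudoBCI ℓ) where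
  open PseudoBCI A
  open ≡-Reasoning

  x⇝x⋓₁y≡𝟏 : ∀ x y → x ⇝ (x ⋓₁ y) ≡ 𝟏
  x⇝x⋓₁y≡𝟏 x y = begin
    x ⇝ ((x ⇒ y) ⇝ y)               ≡⟨ cong₂ (λ s t → s ⇝ ((x ⇒ y) ⇝ t)) (sym (ax3 x)) (sym (ax3 y)) ⟩
    (𝟏 ⇒ x) ⇝ ((x ⇒ y) ⇝ (𝟏 ⇒ y))   ≡⟨ ax1 𝟏 x y ⟩
    𝟏                               ∎

  x≤x⋓₂y : ∀ x y → x ≤ (x ⋓₂ y)
  x≤x⋓₂y x y = begin
    x ⇒ ((x ⇝ y) ⇒ y)               ≡⟨ cong₂ (λ s t → s ⇒ ((x ⇝ y) ⇒ t)) (sym (ax4 x)) (sym (ax4 y)) ⟩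
    (𝟏 ⇝ x) ⇒ ((x ⇝ y) ⇒ (𝟏 ⇝ y))   ≡⟨ ax2 𝟏 x y ⟩
    𝟏                               ∎

  ≤-refl : ∀ x → x ≤ x
  ≤-refl x = begin
    x ⇒ x                   ≡⟨ cong (_⇒ x) (sym (ax4 x)) ⟩
    𝟏 ⋓₂ x                  ≡⟨ sym (ax3 (𝟏 ⋓₂ x)) ⟩
    𝟏 ⇒ (𝟏 ⋓₂ x)            ≡⟨ x≤x⋓₂y 𝟏 x ⟩
    𝟏                       ∎

  ⇝≡𝟏⇒≤ : ∀ {x y} → x ⇝ y ≡ 𝟏 → x ≤ y
  ⇝≡𝟏⇒≤ {x} {y} x⇝y≡𝟏 = begin
    x ⇒ y               ≡⟨ cong (x ⇒_) (sym (ax3 y)) ⟩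
    x ⇒ (𝟏 ⇒ y)         ≡⟨ cong (λ t → x ⇒ (t ⇒ y)) (sym x⇝y≡𝟏) ⟩
    x ⇒ (x ⋓₂ y)        ≡⟨ x≤x⋓₂y x y ⟩
    𝟏                   ∎

  ≤-trans : ∀ {x y z} → x ≤ y → y ≤ z → x ≤ z
  ≤-trans {x} {y} {z} x≤y y≤z = begin
    x ⇒ z                           ≡⟨ sym (trans (ax4 _) (ax4 (x ⇒ z))) ⟩
    𝟏 ⇝ (𝟏 ⇝ (x ⇒ z))               ≡⟨ cong₂ (λ s t → s ⇝ (t ⇝ (x ⇒ z))) (sym x≤y) (sym y≤z) ⟩
    (x ⇒ y) ⇝ ((y ⇒ z) ⇝ (x ⇒ z))   ≡⟨ ax1 x y z ⟩
    𝟏                               ∎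

  ⇒-antitoneˡ : ∀ {x y} z → x ≤ y → (y ⇒ z) ≤ (x ⇒ z)
  ⇒-antitoneˡ {x} {y} z x≤y = ⇝≡𝟏⇒≤ (begin
    (y ⇒ z) ⇝ (x ⇒ z)               ≡⟨ sym (ax4 _) ⟩
    𝟏 ⇝ ((y ⇒ z) ⇝ (x ⇒ z))         ≡⟨ cong (_⇝ ((y ⇒ z) ⇝ (x ⇒ z))) (sym x≤y) ⟩
    (x ⇒ y) ⇝ ((y ⇒ z) ⇝ (x ⇒ z))   ≡⟨ ax1 x y z ⟩
    𝟏                               ∎)

  ⋓₁-⇒ : ∀ x y → (x ⋓₁ y) ⇒ y ≡ x ⇒ y
  ⋓₁-⇒ x y = ax5 _ _ (⇒-antitoneˡ y (⇝≡𝟏⇒≤ (x⇝x⋓₁y≡𝟏 x y))) (x≤x⋓₂y (x ⇒ y) y)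

  ⋓₂𝟏≡𝟏⇒≤𝟏 : ∀ {x} → x ⋓₂ 𝟏 ≡ 𝟏 → x ≤ 𝟏
  ⋓₂𝟏≡𝟏⇒≤𝟏 {x} x⋓₂𝟏≡𝟏 = subst (x ≤_) x⋓₂𝟏≡𝟏 (x≤x⋓₂y x 𝟏)

  -- (x → 1) ⋓₂ 1 is literally (x ⋓₁ 1) → 1.
  ⇒𝟏-⋓₂𝟏 : ∀ x → (x ⇒ 𝟏) ⋓₂ 𝟏 ≡ x ⇒ 𝟏
  ⇒𝟏-⋓₂𝟏 x = ⋓₁-⇒ x 𝟏

  ≤𝟏-if-⇒≤𝟏 : ∀ {b y} → b ≤ 𝟏 → (b ⇒ y) ≤ 𝟏 → y ≤ 𝟏
  ≤𝟏-if-⇒≤𝟏 {b} {y} b≤𝟏 b⇒y≤𝟏 =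
    ≤-trans (subst (λ t → t ≤ (b ⇒ y)) (ax3 y) (⇒-antitoneˡ y b≤𝟏)) b⇒y≤𝟏

module DerivationProperties {ℓ : Level} (A : PseudoBCI ℓ) (d : PseudoBCI.Carrier A → PseudoBCI.Carrier A) where
  open PseudoBCI A
  open PseudoBCIProperties A
  open ≡-Reasoning

  typeI-d[a⇒y]≡𝟏 : IsTypeI d → ∀ {a y} → a ≤ d y → d (a ⇒ y) ≡ 𝟏
  typeI-d[a⇒y]≡𝟏 (d⇒ , _) {a} {y} a≤dy = begin
    d (a ⇒ y)                           ≡⟨ d⇒ a y ⟩
    ((a ⇒ d y) ⇝ (d a ⇒ y)) ⇒ (d a ⇒ y) ≡⟨ cong (λ t → (t ⇝ (d a ⇒ y)) ⇒ (d a ⇒ y)) a≤dy ⟩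
    (𝟏 ⇝ (d a ⇒ y)) ⇒ (d a ⇒ y)         ≡⟨ cong (_⇒ (d a ⇒ y)) (ax4 (d a ⇒ y)) ⟩
    (d a ⇒ y) ⇒ (d a ⇒ y)               ≡⟨ ≤-refl (d a ⇒ y) ⟩
    𝟏                                   ∎

  typeII-d[a⇒y]≡[da⇒y]⋓₂𝟏 : IsTypeII d → ∀ {a y} → a ≤ d y → d (a ⇒ y) ≡ (d a ⇒ y) ⋓₂ 𝟏
  typeII-d[a⇒y]≡[da⇒y]⋓₂𝟏 (d⇒ , _) {a} {y} a≤dy = trans (d⇒ a y) (cong ((d a ⇒ y) ⋓₂_) a≤dy)

proposition3p18 : ∀ {ℓ : Level} (A : PseudoBCI ℓ) (d : PseudoBCI.Carrier A → PseudoBCI.Carrier A)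
    → PseudoBCI.IsTypeI A d → PseudoBCI.IsTypeII A d
    → ∃ (λ a → ∀ x → PseudoBCI._≤_ A a (d x))
    → (d (PseudoBCI.𝟏 A) ≡ PseudoBCI.𝟏 A) × PseudoBCI.IsPseudoBCK A
proposition3p18 A d typeI typeII (a , a≤d) = d𝟏≡𝟏 , x≤𝟏
  where
  open PseudoBCI A
  open PseudoBCIProperties A
  open DerivationProperties A d

  d[a⇒y]≡𝟏 : ∀ y → d (a ⇒ y) ≡ 𝟏
  d[a⇒y]≡𝟏 y = typeI-d[a⇒y]≡𝟏 typeI (a≤d y)

  d𝟏≡𝟏 : d 𝟏 ≡ 𝟏
  d𝟏≡𝟏 = trans (cong d (sym (≤-refl a))) (d[a⇒y]≡𝟏 a)

  [da⇒y]⋓₂𝟏≡𝟏 : ∀ y → (d a ⇒ y) ⋓₂ 𝟏 ≡ 𝟏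
  [da⇒y]⋓₂𝟏≡𝟏 y = trans (sym (typeII-d[a⇒y]≡[da⇒y]⋓₂𝟏 typeII (a≤d y))) (d[a⇒y]≡𝟏 y)

  da≤𝟏 : d a ≤ 𝟏
  da≤𝟏 = trans (sym (⇒𝟏-⋓₂𝟏 (d a))) ([da⇒y]⋓₂𝟏≡𝟏 𝟏)

  x≤𝟏 : IsPseudoBCK
  x≤𝟏 y = ≤𝟏-if-⇒≤𝟏 da≤𝟏 (⋓₂𝟏≡𝟏⇒≤𝟏 ([da⇒y]⋓₂𝟏≡𝟏 y))
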